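{- Let $p$ be a prime, let $A$ be a matrix over $GF(p)$ whose columns are labelled by a finite set $E$, let $M=M[A]$, let $a,b\in E$ be distinct, $\alpha\in GF(p)\setminus\{0\}$, and let $M_{a,b}$ be the splitting matroid. If $M$ is Eulerian and has a $p$-decomposition, then $M_{a,b}$ is Eulerian.
   Context: A matroid is Eulerian if its ground set is a disjoint union of circuits. The splitting matroid $M_{a,b}$ is $M[A_{a,b}]$, where $A_{a,b}$ is $A$ with an appended row having entries $\alpha$ in columns $a,b$ and $0$ elsewhere. For a circuit $C$ of $M$, its columns satisfy $\sum_{u\in C}c_u u=0$ over $GF(p)$ with all $c_u\ne0$ (unique up to nonzero scalar). $C$ is a $p$-circuit if $a,b\in C$ and $c_a+c_b=0$; an $np$-circuit if $|C\cap\{a,b\}|=1$, or $a,b\in C$ and $c_a+c_b\ne0$. Let $\mathcal{C}_0$ be the set of circuits of $M$ that are $p$-circuits or disjoint from $\{a,b\}$. A set $C\cup I$, with $C$ an $np$-circuit of $M$, $I$ independent in $M$, $C\cap I=\emptyset$, $\{a,b\}\subseteq C\cup I$, is $p$-dependent if it contains no member of $\mathcal{C}_0$ and there are nonzero scalars $\beta_x$ ($x\in C\cup I$) with $\sum\beta_x x=0$ and $\beta_a+\beta_b=0$. Let $\mathcal{C}_1$ be the set of inclusion-minimal $p$-dependent sets $C\cup I$ containing no union $C_1'\cup C_2'$ of two disjoint $np$-circuits. Let $\mathcal{C}_2$ be the set of inclusion-minimal sets $C_1\cup C_2$ with $C_1,C_2$ circuits of $M$, $a\in C_1$, $b\in C_2$,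 $C_1\cap C_2=\emptyset$, such that no member of $\mathcal{C}_0\cup\mathcal{C}_1$ is a proper subset of $C_1\cup C_2$. If $M$ is Eulerian with $E=C_1\cup\dots\cup C_k$ a partition into circuits, the collection $\{C_1,\dots,C_k\}$ is a $p$-decomposition of $M$ if either $a,b\in C_i$ for some $i$ and $C_i$ is a $p$-circuit, or $a\in C_i$, $b\in C_j$ for some $i\ne j$ and $C_i\cup C_j\in\mathcal{C}_2$. -}

module Defs where

-- Elements of GF(p) are represented by
-- natural numbers, read modulo p: x is zero in GF(p) iff p ∣ x.  All sums
-- and products are computed in ℕ and then compared modulo p, which is exactly
-- arithmetic in GF(p) = ℤ/pℤ.

open import Data.Nat using (ℕ; zero; suc; _+_; _*_)
open import Data.Nat.Divisibility using (_∣_)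
open import Data.Fin using (Fin; zero; suc)
open import Data.Fin.Properties using (_≟_)
open import Data.Fin.Subset using (Subset; _∈_; _∉_; _⊆_; _⊂_; _∪_; _∩_; Empty)
open import Data.Bool using (if_then_else_; _∨_)
open import Data.Product using (Σ; ∃; ∃-syntax; _×_; _,_)
open import Data.Sum using (_⊎_)
open import Relation.Nullary using (¬_; does)
open import Relation.Binary.PropositionalEquality using (_≡_; _≢_)

Σᶠ : ∀ {n} → (Fin n → ℕ) → ℕ
Σᶠ {zero}  f = 0
Σᶠ {suc n} f = f zero + Σᶠ (λ i → f (suc i))

module VectorMatroid (p : ℕ) {m n : ℕ} (A : Fin m → Fin n → ℕ) where

  Zero : ℕ → Set
  Zero x = p ∣ x

  Kernel : (Fin n → ℕ) → Set
  Kernel c = ∀ (i : Fin m) → Zero (Σᶠ (λ u → c u * A i u))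

  SupportedOn : (Fin n → ℕ) → Subset n → Set
  SupportedOn c X = ∀ u → u ∉ X → Zero (c u)

  Dependent : Subset n → Set
  Dependent X = ∃[ c ] (Kernel c × SupportedOn c X × ∃[ u ] (u ∈ X × ¬ Zero (c u)))

  Independent : Subset n → Set
  Independent X = ¬ Dependent X

  Circuit : Subset n → Set
  Circuit C = Dependent C × (∀ Y → Y ⊂ C → Independent Y)

  CircuitVec : Subset n → (Fin n → ℕ) → Set
  CircuitVec C c = Kernel c × (∀ u → u ∈ C → ¬ Zero (c u)) × SupportedOn c C

  IsCircuitPartition : ∀ {k} → (Fin k → Subset n) → Set
  IsCircuitPartition {k} Cs =
    (∀ i → Circuit (Cs i)) ×
    (∀ (i j : Fin k) → i ≢ j → Empty (Cs i ∩ Cs j)) ×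
    (∀ (e : Fin n) → ∃[ i ] (e ∈ Cs i))

  Eulerian : Set
  Eulerian = ∃[ k ] Σ (Fin k → Subset n) IsCircuitPartition

  module Split (a b : Fin n) where

    PCircuit : Subset n → Set
    PCircuit C = Circuit C × a ∈ C × b ∈ C × ∃[ c ] (CircuitVec C c × Zero (c a + c b))

    NPCircuit : Subset n → Set
    NPCircuit C = Circuit C ×
      ((a ∈ C × b ∉ C) ⊎ (a ∉ C × b ∈ C) ⊎
       (a ∈ C × b ∈ C × ∃[ c ] (CircuitVec C c × ¬ Zero (c a + c b))))

    InC₀ : Subset n → Set
    InC₀ D = Circuit D × (PCircuit D ⊎ (a ∉ D × b ∉ D))

    PDependent : Subset n → Set
    PDependent X = ∃[ C ] ∃[ I ]
      (NPCircuit C × Independent I × Empty (C ∩ I) × X ≡ C ∪ I ×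
       a ∈ X × b ∈ X ×
       (∀ D → D ⊆ X → ¬ InC₀ D) ×
       ∃[ β ] (Kernel β × (∀ x → x ∈ X → ¬ Zero (β x)) × SupportedOn β X ×
               Zero (β a + β b)))

    InC₁ : Subset n → Set
    InC₁ X = PDependent X × (∀ Y → Y ⊂ X → ¬ PDependent Y) ×
      ¬ (∃[ C₁ ] ∃[ C₂ ] (NPCircuit C₁ × NPCircuit C₂ × Empty (C₁ ∩ C₂) × (C₁ ∪ C₂) ⊆ X))

    C₂Candidate : Subset n → Set
    C₂Candidate X = ∃[ C₁ ] ∃[ C₂ ]
      (Circuit C₁ × Circuit C₂ × a ∈ C₁ × b ∈ C₂ × Empty (C₁ ∩ C₂) × X ≡ C₁ ∪ C₂ ×
       (∀ D → D ⊂ X → ¬ (InC₀ D ⊎ InC₁ D)))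

    InC₂ : Subset n → Set
    InC₂ X = C₂Candidate X × (∀ Y → Y ⊂ X → ¬ C₂Candidate Y)

    IsPDecomposition : ∀ {k} → (Fin k → Subset n) → Set
    IsPDecomposition {k} Cs = IsCircuitPartition Cs ×
      ((∃[ i ] (a ∈ Cs i × b ∈ Cs i × PCircuit (Cs i))) ⊎
       (∃[ i ] ∃[ j ] (i ≢ j × a ∈ Cs i × b ∈ Cs j × InC₂ (Cs i ∪ Cs j))))

    HasPDecomposition : Set
    HasPDecomposition = ∃[ k ] Σ (Fin k → Subset n) IsPDecomposition

-- A_{a,b}: A with an appended row (placed first) with α in columns a, b and 0 elsewhere
splitMatrix : ∀ {m n} → (Fin m → Fin n → ℕ) → ℕ → Fin n → Fin n → Fin (suc m) → Fin n → ℕ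
splitMatrix A α a b zero    u = if does (u ≟ a) ∨ does (u ≟ b) then α else 0
splitMatrix A α a b (suc i) u = A i u

-- A set X ∈ 𝒞₂ is a circuit of the splitting matroid: if C₁ ∋ a and C₂ ∋ b are the
-- two circuits forming X with coefficient vectors c₁, c₂, then c₂(b)·c₁ − c₁(a)·c₂ is
-- a dependency of X satisfying the appended row.  A smaller circuit D of M_{a,b}
-- inside X either avoids a and b, and then contains a circuit of 𝒞₀, or contains
-- both, and then D = C ∪ (D ∖ C) for any circuit C ⊆ D of M exhibits D ∈ 𝒞₁; two
-- disjoint np-circuits in D would form a smaller candidate for 𝒞₂.  Circuits of 𝒞₀
-- stay circuits of M_{a,b}, so replacing the two blocks C_i, C_j of the
-- p-decomposition by their union (or keeping the decomposition when a single
-- p-circuit contains a and b) partitions E into circuits of M_{a,b}.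
module Submission where

open import Defs
open import Data.Nat using (ℕ)
open import Data.Nat.Divisibility using (_∣_)
open import Data.Nat.Primality using (Prime)
open import Data.Fin using (Fin)
open import Relation.Nullary using (¬_)
open import Relation.Binary.PropositionalEquality using (_≢_)

open import Algebra.Properties.CommutativeSemigroup using (interchange)
open import Data.Bool using (if_then_else_)
open import Data.Empty using (⊥; ⊥-elim)
open import Function using (_∘_)
open import Data.Fin using (zero; suc; punchIn; punchOut)
open import Data.Fin.Properties using (_≟_; punchIn-injective; punchInᵢ≢i; punchIn-punchOut)
open import Data.Fin.Subset using (Subset; _∈_; _∉_; _⊆_; _⊂_; _∪_; _∩_; ∁; _-_; Empty; ∣_∣)
open import Data.Fin.Subset.Properties
  using (_∈?_; ⊆-refl; ⊆-trans; ⊆-antisym; ⊆-⊂-trans; ⊂-trans; p⊂q⇒p⊆q; p⊂q⇒∣p∣<∣q∣;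
         x∈p∩q⁺; x∈p∩q⁻; x∈p∪q⁺; x∈p∪q⁻; p∩q⊆p; x∈∁p⇒x∉p; x∉p⇒x∈∁p; p∩q⊆q;
         ∩-comm; ∪-comm; x∈p⇒p-x⊂p; x∈p∧x≢y⇒x∈p-y)
open import Data.Nat using (zero; suc; _+_; _*_; _<_; pred)
open import Data.Nat.Divisibility using (_∣?_; ∣m∣n⇒∣m+n; ∣m+n∣m⇒∣n; ∣n⇒∣m*n; ∣m⇒∣m*n; m∣m*n)
open import Data.Nat.Primality using (euclidsLemma; prime⇒nonZero)
open import Data.Nat.Properties
  using (+-comm; +-identityʳ; *-zeroʳ; *-assoc; *-distribˡ-+; *-distribʳ-+; suc-pred;
         ≤-refl; ≤-pred; <-≤-trans; +-commutativeSemigroup)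
open import Data.Nat.Tactic.RingSolver using (solve-∀)
open import Data.Product using (∃; ∃-syntax; _×_; _,_; proj₁; proj₂)
open import Data.Sum using (_⊎_; inj₁; inj₂; [_,_])
open import Relation.Nullary using (does; yes; no)
open import Relation.Binary.PropositionalEquality
  using (_≡_; refl; sym; trans; cong; cong₂; subst; module ≡-Reasoning)

Σᶠ-cong : ∀ {k} {f g : Fin k → ℕ} → (∀ u → f u ≡ g u) → Σᶠ f ≡ Σᶠ g
Σᶠ-cong {zero}  f≗g = refl
Σᶠ-cong {suc k} f≗g = cong₂ _+_ (f≗g zero) (Σᶠ-cong (λ u → f≗g (suc u)))

Σᶠ-+ : ∀ {k} (f g : Fin k → ℕ) → Σᶠ (λ u → f u + g u) ≡ Σᶠ f + Σᶠ g
Σᶠ-+ {zero}  f g = refl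
Σᶠ-+ {suc k} f g rewrite Σᶠ-+ (λ u → f (suc u)) (λ u → g (suc u)) =
  interchange +-commutativeSemigroup (f zero) (g zero) _ _

Σᶠ-*ˡ : ∀ {k} x (f : Fin k → ℕ) → Σᶠ (λ u → x * f u) ≡ x * Σᶠ f
Σᶠ-*ˡ {zero}  x f = sym (*-zeroʳ x)
Σᶠ-*ˡ {suc k} x f rewrite Σᶠ-*ˡ x (λ u → f (suc u)) = sym (*-distribˡ-+ x (f zero) _)

Σᶠ-0 : ∀ {k} → Σᶠ {k} (λ _ → 0) ≡ 0
Σᶠ-0 {zero}  = refl
Σᶠ-0 {suc k} = Σᶠ-0 {k}

Σᶠ-indicator : ∀ {k} (a : Fin k) x → Σᶠ (λ u → if does (u ≟ a) then x else 0) ≡ x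
Σᶠ-indicator {suc k} zero    x = trans (cong (x +_) (Σᶠ-0 {k})) (+-identityʳ x)
Σᶠ-indicator {suc k} (suc a) x = Σᶠ-indicator a x

∣m+n∣n⇒∣m : ∀ {d m n} → d ∣ m + n → d ∣ n → d ∣ m
∣m+n∣n⇒∣m {d} {m} {n} d∣m+n = ∣m+n∣m⇒∣n (subst (d ∣_) (+-comm m n) d∣m+n)

module _ {n : ℕ} where

  Empty∩⇒∉ : ∀ {P Q : Subset n} {x} → Empty (P ∩ Q) → x ∈ Q → x ∉ P
  Empty∩⇒∉ P∩Q=∅ x∈Q x∈P = P∩Q=∅ (_ , x∈p∩q⁺ (x∈P , x∈Q))

  Empty∪∩ : ∀ {P Q R : Subset n} → Empty (P ∩ R) → Empty (Q ∩ R) → Empty ((P ∪ Q) ∩ R)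
  Empty∪∩ {P} {Q} {R} P∩R=∅ Q∩R=∅ (x , x∈) with x∈p∩q⁻ (P ∪ Q) R x∈
  ... | x∈P∪Q , x∈R = [ Empty∩⇒∉ P∩R=∅ x∈R , Empty∩⇒∉ Q∩R=∅ x∈R ] (x∈p∪q⁻ P Q x∈P∪Q)

  ∪-⊆ : ∀ {P Q R : Subset n} → P ⊆ R → Q ⊆ R → P ∪ Q ⊆ R
  ∪-⊆ {P} {Q} P⊆R Q⊆R x∈ = [ P⊆R , Q⊆R ] (x∈p∪q⁻ P Q x∈)

  ⊆⇒≡∪─ : ∀ {C D : Subset n} → C ⊆ D → D ≡ C ∪ (D ∩ ∁ C)
  ⊆⇒≡∪─ {C} {D} C⊆D = ⊆-antisym D⊆ (∪-⊆ C⊆D (p∩q⊆p D (∁ C)))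
    where
    D⊆ : D ⊆ C ∪ (D ∩ ∁ C)
    D⊆ {x} x∈D with x ∈? C
    ... | yes x∈C = x∈p∪q⁺ (inj₁ x∈C)
    ... | no  x∉C = x∈p∪q⁺ (inj₂ (x∈p∩q⁺ (x∈D , x∉p⇒x∈∁p x∉C)))

  -- P is not assumed decidable, so only the double negation is constructive.
  ¬¬-minimal : (P : Subset n → Set) → ∀ {X} → P X →
               ¬ ¬ (∃[ Y ] (Y ⊆ X × P Y × (∀ Z → Z ⊂ Y → ¬ P Z)))
  ¬¬-minimal P {X} PX noMinimal = descend (suc ∣ X ∣) X ≤-refl ⊆-refl PX
    where
    descend : ∀ bound Y → ∣ Y ∣ < bound → Y ⊆ X → P Y → ⊥
    descend (suc bound) Y ∣Y∣<bound Y⊆X PY = noMinimal (Y , Y⊆X , PY , λ Z Z⊂Y PZ →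
      descend bound Z (<-≤-trans (p⊂q⇒∣p∣<∣q∣ Z⊂Y) (≤-pred ∣Y∣<bound))
              (⊆-trans (p⊂q⇒p⊆q Z⊂Y) Y⊆X) PZ)

module _ {n k : ℕ} (Cs : Fin (suc k) → Subset n) {i j : Fin (suc k)} (j≢i : j ≢ i) where

  mergeBlocks : Fin k → Subset n
  mergeBlocks l with punchIn j l ≟ i
  ... | yes _ = Cs i ∪ Cs j
  ... | no  _ = Cs (punchIn j l)

  mergeBlocks-elim : (P : Subset n → Set) → P (Cs i ∪ Cs j) →
                     (∀ t → t ≢ i → t ≢ j → P (Cs t)) → ∀ l → P (mergeBlocks l)
  mergeBlocks-elim P P-merged P-other l with punchIn j l ≟ i
  ... | yes _   = P-merged
  ... | no  t≢i = P-other (punchIn j l) t≢i (punchInᵢ≢i j l)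

  ⊆-mergeBlocks : ∀ l → Cs (punchIn j l) ⊆ mergeBlocks l
  ⊆-mergeBlocks l {x} x∈ with punchIn j l ≟ i
  ... | yes t≡i = x∈p∪q⁺ (inj₁ (subst (λ t → x ∈ Cs t) t≡i x∈))
  ... | no  _   = x∈

  Csʲ⊆mergeBlocks : Cs j ⊆ mergeBlocks (punchOut j≢i)
  Csʲ⊆mergeBlocks x∈ with punchIn j (punchOut j≢i) ≟ i
  ... | yes _   = x∈p∪q⁺ (inj₂ x∈)
  ... | no  t≢i = ⊥-elim (t≢i (punchIn-punchOut j≢i))

  mergeBlocks-covers : (∀ x → ∃[ t ] (x ∈ Cs t)) → ∀ x → ∃[ l ] (x ∈ mergeBlocks l)
  mergeBlocks-covers cover x with cover x
  ... | t , x∈Csᵗ with t ≟ j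
  ...   | yes refl = punchOut j≢i , Csʲ⊆mergeBlocks x∈Csᵗ
  ...   | no  t≢j  = punchOut (t≢j ∘ sym) ,
                     ⊆-mergeBlocks _ (subst (λ s → x ∈ Cs s) (sym (punchIn-punchOut (t≢j ∘ sym))) x∈Csᵗ)

  module _ (disj : ∀ s t → s ≢ t → Empty (Cs s ∩ Cs t)) where

    merged-disjoint : ∀ t → t ≢ i → t ≢ j → Empty ((Cs i ∪ Cs j) ∩ Cs t)
    merged-disjoint t t≢i t≢j = Empty∪∩ (disj i t (t≢i ∘ sym)) (disj j t (t≢j ∘ sym))

    mergeBlocks-disjoint : ∀ l l′ → l ≢ l′ → Empty (mergeBlocks l ∩ mergeBlocks l′)
    mergeBlocks-disjoint l l′ l≢l′ with punchIn j l ≟ i | punchIn j l′ ≟ i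
    ... | yes t≡i | yes t′≡i = ⊥-elim (l≢l′ (punchIn-injective j l l′ (trans t≡i (sym t′≡i))))
    ... | yes _   | no  t′≢i = merged-disjoint _ t′≢i (punchInᵢ≢i j l′)
    ... | no  t≢i | yes _    = subst Empty (∩-comm _ _) (merged-disjoint _ t≢i (punchInᵢ≢i j l))
    ... | no  _   | no  _    = disj _ _ (l≢l′ ∘ punchIn-injective j l l′)

module VectorMatroidProperties (p : ℕ) {m n : ℕ} (A : Fin m → Fin n → ℕ) where
  open VectorMatroid p A

  Kernel-linear : ∀ x y {c d} → Kernel c → Kernel d → Kernel (λ u → x * c u + y * d u)
  Kernel-linear x y {c} {d} Ac=0 Ad=0 i =
    subst Zero (sym row) (∣m∣n⇒∣m+n (∣n⇒∣m*n x (Ac=0 i)) (∣n⇒∣m*n y (Ad=0 i)))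
    where
    open ≡-Reasoning
    row : Σᶠ (λ u → (x * c u + y * d u) * A i u)
        ≡ x * Σᶠ (λ u → c u * A i u) + y * Σᶠ (λ u → d u * A i u)
    row = begin
      Σᶠ (λ u → (x * c u + y * d u) * A i u)
        ≡⟨ Σᶠ-cong (λ u → trans (*-distribʳ-+ (A i u) (x * c u) (y * d u))
                                (cong₂ _+_ (*-assoc x (c u) (A i u)) (*-assoc y (d u) (A i u)))) ⟩
      Σᶠ (λ u → x * (c u * A i u) + y * (d u * A i u))
        ≡⟨ Σᶠ-+ (λ u → x * (c u * A i u)) (λ u → y * (d u * A i u)) ⟩
      Σᶠ (λ u → x * (c u * A i u)) + Σᶠ (λ u → y * (d u * A i u))
        ≡⟨ cong₂ _+_ (Σᶠ-*ˡ x (λ u → c u * A i u)) (Σᶠ-*ˡ y (λ u → d u * A i u)) ⟩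
      x * Σᶠ (λ u → c u * A i u) + y * Σᶠ (λ u → d u * A i u) ∎

  SupportedOn⇒∈ : ∀ {c X u} → SupportedOn c X → ¬ Zero (c u) → u ∈ X
  SupportedOn⇒∈ {c} {X} {u} supp cu≠0 with u ∈? X
  ... | yes u∈X = u∈X
  ... | no  u∉X = ⊥-elim (cu≠0 (supp u u∉X))

  SupportedOn-remove : ∀ {c X u} → SupportedOn c X → Zero (c u) → SupportedOn c (X - u)
  SupportedOn-remove {c} {X} {u} supp cu=0 v v∉X-u with v ≟ u
  ... | yes refl = cu=0
  ... | no  v≢u with v ∈? X
  ...   | yes v∈X = ⊥-elim (v∉X-u (x∈p∧x≢y⇒x∈p-y v∈X v≢u))
  ...   | no  v∉X = supp v v∉X

  circuit⇒CircuitVec : ∀ {C} → Circuit C → ∃ (CircuitVec C)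
  circuit⇒CircuitVec {C} ((c , Ac=0 , supp , u₀ , _ , cu₀≠0) , minimal) =
    c , Ac=0 , nonzero , supp
    where
    nonzero : ∀ u → u ∈ C → ¬ Zero (c u)
    nonzero u u∈C cu=0 = minimal (C - u) (x∈p⇒p-x⊂p u∈C)
      (c , Ac=0 , SupportedOn-remove supp cu=0 , u₀ ,
       x∈p∧x≢y⇒x∈p-y (SupportedOn⇒∈ supp cu₀≠0) (λ { refl → cu₀≠0 cu=0 }) , cu₀≠0)

  ¬¬circuit⊆ : ∀ {X} → Dependent X → ¬ ¬ (∃[ C ] (C ⊆ X × Circuit C))
  ¬¬circuit⊆ = ¬¬-minimal Dependent

module Splitting (p : ℕ) (p-prime : Prime p) {m n : ℕ} (A : Fin m → Fin n → ℕ)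
                 (a b : Fin n) (a≢b : a ≢ b) (α : ℕ) (α≢0 : ¬ (p ∣ α)) where

  module M  = VectorMatroid p A
  module N  = VectorMatroid p (splitMatrix A α a b)
  module Mᴾ = VectorMatroidProperties p A
  module Nᴾ = VectorMatroidProperties p (splitMatrix A α a b)
  open M.Split a b

  splitRow-Σ : ∀ (d : Fin n → ℕ) → Σᶠ (λ u → d u * splitMatrix A α a b zero u) ≡ (d a + d b) * α
  splitRow-Σ d = begin
    Σᶠ (λ u → d u * splitMatrix A α a b zero u)  ≡⟨ Σᶠ-cong entry ⟩
    Σᶠ (λ u → at a u + at b u)                   ≡⟨ Σᶠ-+ (at a) (at b) ⟩
    Σᶠ (at a) + Σᶠ (at b)                        ≡⟨ cong₂ _+_ (Σᶠ-indicator a _) (Σᶠ-indicator b _) ⟩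
    d a * α + d b * α                            ≡⟨ *-distribʳ-+ α (d a) (d b) ⟨
    (d a + d b) * α                              ∎
    where
    open ≡-Reasoning
    at : Fin n → Fin n → ℕ
    at x u = if does (u ≟ x) then d x * α else 0
    entry : ∀ u → d u * splitMatrix A α a b zero u ≡ at a u + at b u
    entry u with u ≟ a | u ≟ b
    ... | yes refl | yes refl = ⊥-elim (a≢b refl)
    ... | yes refl | no  _    = sym (+-identityʳ _)
    ... | no  _    | yes refl = refl
    ... | no  _    | no  _    = *-zeroʳ (d u)

  Kernel-split⁻ : ∀ {d} → N.Kernel d → M.Kernel d × p ∣ d a + d b
  Kernel-split⁻ {d} A'd=0 =
    (λ i → A'd=0 (suc i)) ,
    [ (λ p∣da+db → p∣da+db) , (λ p∣α → ⊥-elim (α≢0 p∣α)) ]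
      (euclidsLemma (d a + d b) α p-prime (subst (p ∣_) (splitRow-Σ d) (A'd=0 zero)))

  Kernel-split⁺ : ∀ {d} → M.Kernel d → p ∣ d a + d b → N.Kernel d
  Kernel-split⁺ {d} Ad=0 balanced zero    = subst (p ∣_) (sym (splitRow-Σ d)) (∣m⇒∣m*n α balanced)
  Kernel-split⁺     Ad=0 balanced (suc i) = Ad=0 i

  Dependent-split⁻ : ∀ {X} → N.Dependent X → M.Dependent X
  Dependent-split⁻ (d , A'd=0 , rest) = d , proj₁ (Kernel-split⁻ {d} A'd=0) , rest

  Circuit-split⁺ : ∀ {C} → M.Circuit C → N.Dependent C → N.Circuit C
  Circuit-split⁺ (_ , minimal) depC = depC , λ Y Y⊂C depY → minimal Y Y⊂C (Dependent-split⁻ depY)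

  InC₀⇒splitCircuit : ∀ {C} → InC₀ C → N.Circuit C
  InC₀⇒splitCircuit (circ , inj₁ (_ , a∈C , _ , c , (Ac=0 , nonzero , supp) , balanced)) =
    Circuit-split⁺ circ (c , Kernel-split⁺ {c} Ac=0 balanced , supp , a , a∈C , nonzero a a∈C)
  InC₀⇒splitCircuit (circ@((c , Ac=0 , supp , u , u∈C , cu≠0) , _) , inj₂ (a∉C , b∉C)) =
    Circuit-split⁺ circ
      (c , Kernel-split⁺ {c} Ac=0 (∣m∣n⇒∣m+n (supp a a∉C) (supp b b∉C)) , supp , u , u∈C , cu≠0)

  ¬InC₀⇒NPCircuit : ∀ {C} → M.Circuit C → ¬ InC₀ C → NPCircuit C
  ¬InC₀⇒NPCircuit {C} circ ¬C₀ with a ∈? C | b ∈? C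
  ... | no  a∉C | no  b∉C = ⊥-elim (¬C₀ (circ , inj₂ (a∉C , b∉C)))
  ... | yes a∈C | no  b∉C = circ , inj₁ (a∈C , b∉C)
  ... | no  a∉C | yes b∈C = circ , inj₂ (inj₁ (a∉C , b∈C))
  ... | yes a∈C | yes b∈C with Mᴾ.circuit⇒CircuitVec circ
  ...   | c , cvec with p ∣? (c a + c b)
  ...     | yes balanced = ⊥-elim (¬C₀ (circ , inj₁ (circ , a∈C , b∈C , c , cvec , balanced)))
  ...     | no  unbalanced = circ , inj₂ (inj₂ (a∈C , b∈C , c , cvec , unbalanced))

  NPCircuit-meets : ∀ {C} → NPCircuit C → a ∈ C ⊎ b ∈ C
  NPCircuit-meets (_ , inj₁ (a∈C , _))                = inj₁ a∈C
  NPCircuit-meets (_ , inj₂ (inj₁ (_ , b∈C)))         = inj₂ b∈C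
  NPCircuit-meets (_ , inj₂ (inj₂ (a∈C , _)))         = inj₁ a∈C

  disjointNPCircuits-separate : ∀ {C₁ C₂} → NPCircuit C₁ → NPCircuit C₂ → Empty (C₁ ∩ C₂) →
                                (a ∈ C₁ × b ∈ C₂) ⊎ (a ∈ C₂ × b ∈ C₁)
  disjointNPCircuits-separate np₁ np₂ disj with NPCircuit-meets np₁ | NPCircuit-meets np₂
  ... | inj₁ a∈C₁ | inj₁ a∈C₂ = ⊥-elim (Empty∩⇒∉ disj a∈C₂ a∈C₁)
  ... | inj₁ a∈C₁ | inj₂ b∈C₂ = inj₁ (a∈C₁ , b∈C₂)
  ... | inj₂ b∈C₁ | inj₁ a∈C₂ = inj₂ (a∈C₂ , b∈C₁)
  ... | inj₂ b∈C₁ | inj₂ b∈C₂ = ⊥-elim (Empty∩⇒∉ disj b∈C₂ b∈C₁)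

  -- c₂(b)·c₁ − c₁(a)·c₂, with −1 represented by pred p.
  disjointCircuits⇒splitDependent : ∀ {C₁ C₂ c₁ c₂} → M.CircuitVec C₁ c₁ → M.CircuitVec C₂ c₂ →
                                    a ∈ C₁ → b ∈ C₂ → Empty (C₁ ∩ C₂) → N.Dependent (C₁ ∪ C₂)
  disjointCircuits⇒splitDependent {C₁} {C₂} {c₁} {c₂}
    (Ac₁=0 , c₁≠0 , supp₁) (Ac₂=0 , c₂≠0 , supp₂) a∈C₁ b∈C₂ disj =
    e , Kernel-split⁺ {e} (Mᴾ.Kernel-linear y w {c₁} {c₂} Ac₁=0 Ac₂=0) balanced , supp , a ,
    x∈p∪q⁺ (inj₁ a∈C₁) , ea≠0
    where
    instance _ = prime⇒nonZero p-prime
    y = c₂ b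
    w = pred p * c₁ a
    e : Fin n → ℕ
    e u = y * c₁ u + w * c₂ u
    c₁b=0 : p ∣ c₁ b
    c₁b=0 = supp₁ b (Empty∩⇒∉ disj b∈C₂)
    c₂a=0 : p ∣ c₂ a
    c₂a=0 = supp₂ a (λ a∈C₂ → Empty∩⇒∉ disj a∈C₂ a∈C₁)
    cross : y * c₁ a + w * c₂ b ≡ p * (c₁ a * y)
    cross = trans (factor y (c₁ a) (pred p)) (cong (_* (c₁ a * y)) (suc-pred p))
      where
      factor : ∀ y x r → y * x + r * x * y ≡ suc r * (x * y)
      factor = solve-∀
    balanced : p ∣ e a + e b
    balanced = subst (p ∣_) (regroup y w (c₁ a) (c₂ a) (c₁ b) (c₂ b))
      (∣m∣n⇒∣m+n (subst (p ∣_) (sym cross) (m∣m*n _))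
                 (∣m∣n⇒∣m+n (∣n⇒∣m*n y c₁b=0) (∣n⇒∣m*n w c₂a=0)))
      where
      regroup : ∀ y w c₁a c₂a c₁b c₂b → (y * c₁a + w * c₂b) + (y * c₁b + w * c₂a)
                                      ≡ (y * c₁a + w * c₂a) + (y * c₁b + w * c₂b)
      regroup = solve-∀
    supp : M.SupportedOn e (C₁ ∪ C₂)
    supp u u∉ = ∣m∣n⇒∣m+n (∣n⇒∣m*n y (supp₁ u (λ u∈ → u∉ (x∈p∪q⁺ (inj₁ u∈)))))
                          (∣n⇒∣m*n w (supp₂ u (λ u∈ → u∉ (x∈p∪q⁺ (inj₂ u∈)))))
    ea≠0 : ¬ (p ∣ e a)
    ea≠0 p∣ea = [ c₂≠0 b b∈C₂ , c₁≠0 a a∈C₁ ]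
      (euclidsLemma y (c₁ a) p-prime (∣m+n∣n⇒∣m p∣ea (∣n⇒∣m*n w c₂a=0)))

  PDependent⇒splitDependent : ∀ {Y} → PDependent Y → N.Dependent Y
  PDependent⇒splitDependent (_ , _ , _ , _ , _ , _ , a∈Y , _ , _ , β , Aβ=0 , β≠0 , supp , balanced) =
    β , Kernel-split⁺ {β} Aβ=0 balanced , supp , a , a∈Y , β≠0 a a∈Y

  splitCircuit-∉a⇒∉b : ∀ {D} → N.Circuit D → a ∉ D → b ∉ D
  splitCircuit-∉a⇒∉b circD a∉D b∈D with Nᴾ.circuit⇒CircuitVec circD
  ... | d , A'd=0 , nonzero , supp =
    nonzero b b∈D (∣m+n∣m⇒∣n (proj₂ (Kernel-split⁻ {d} A'd=0)) (supp a a∉D))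

  module BelowC₂ {X : Subset n} (noC₀C₁ : ∀ Z → Z ⊂ X → ¬ (InC₀ Z ⊎ InC₁ Z))
                 (noSmallerCandidate : ∀ Y → Y ⊂ X → ¬ C₂Candidate Y) where

    separatedNPCircuits-∪⊄ : ∀ {C₁ C₂} → NPCircuit C₁ → NPCircuit C₂ → a ∈ C₁ → b ∈ C₂ →
                             Empty (C₁ ∩ C₂) → ¬ (C₁ ∪ C₂ ⊂ X)
    separatedNPCircuits-∪⊄ (circ₁ , _) (circ₂ , _) a∈C₁ b∈C₂ disj C₁∪C₂⊂X =
      noSmallerCandidate _ C₁∪C₂⊂X
        (_ , _ , circ₁ , circ₂ , a∈C₁ , b∈C₂ , disj , refl ,
         λ Z Z⊂C₁∪C₂ → noC₀C₁ Z (⊂-trans Z⊂C₁∪C₂ C₁∪C₂⊂X))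

    no-disjointNPCircuits : ∀ {D} → D ⊂ X →
      ¬ (∃[ C₁ ] ∃[ C₂ ] (NPCircuit C₁ × NPCircuit C₂ × Empty (C₁ ∩ C₂) × (C₁ ∪ C₂) ⊆ D))
    no-disjointNPCircuits D⊂X (C₁ , C₂ , np₁ , np₂ , disj , C₁∪C₂⊆D)
      with disjointNPCircuits-separate np₁ np₂ disj
    ... | inj₁ (a∈C₁ , b∈C₂) =
      separatedNPCircuits-∪⊄ np₁ np₂ a∈C₁ b∈C₂ disj (⊆-⊂-trans C₁∪C₂⊆D D⊂X)
    ... | inj₂ (a∈C₂ , b∈C₁) =
      separatedNPCircuits-∪⊄ np₂ np₁ a∈C₂ b∈C₁ (subst Empty (∩-comm C₁ C₂) disj)
        (subst (_⊂ X) (∪-comm C₁ C₂) (⊆-⊂-trans C₁∪C₂⊆D D⊂X))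

    splitCircuit-∈C₁ : ∀ {D C d} → D ⊂ X → N.Circuit D → N.CircuitVec D d → a ∈ D →
                       C ⊆ D → M.Circuit C → InC₁ D
    splitCircuit-∈C₁ {D} {C} {d} D⊂X circD (A'd=0 , d≠0 , supp) a∈D C⊆D circC =
      (C , I , npC , I-independent , C∩I=∅ , ⊆⇒≡∪─ C⊆D , a∈D , b∈D , noC₀ , d , Ad=0 , d≠0 , supp , balanced) ,
      (λ Y Y⊂D pdepY → proj₂ circD Y Y⊂D (PDependent⇒splitDependent pdepY)) ,
      no-disjointNPCircuits D⊂X
      where
      Ad=0     = proj₁ (Kernel-split⁻ {d} A'd=0)
      balanced = proj₂ (Kernel-split⁻ {d} A'd=0)
      b∈D : b ∈ D
      b∈D = Mᴾ.SupportedOn⇒∈ supp (λ p∣db → d≠0 a a∈D (∣m+n∣n⇒∣m balanced p∣db))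
      noC₀ : ∀ Z → Z ⊆ D → ¬ InC₀ Z
      noC₀ Z Z⊆D C₀Z = noC₀C₁ Z (⊆-⊂-trans Z⊆D D⊂X) (inj₁ C₀Z)
      npC = ¬InC₀⇒NPCircuit circC (noC₀ C C⊆D)
      I = D ∩ ∁ C
      I⊆D : I ⊆ D
      I⊆D = p∩q⊆p D (∁ C)
      C∩I=∅ : Empty (C ∩ I)
      C∩I=∅ (x , x∈C∩I) with x∈p∩q⁻ C I x∈C∩I
      ... | x∈C , x∈I = x∈∁p⇒x∉p (p∩q⊆q D (∁ C) x∈I) x∈C
      I-independent : M.Independent I
      I-independent depI = Mᴾ.¬¬circuit⊆ depI λ (C′ , C′⊆I , circC′) →
        no-disjointNPCircuits D⊂X
          (C , C′ , npC , ¬InC₀⇒NPCircuit circC′ (noC₀ C′ (⊆-trans C′⊆I I⊆D)) ,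
           (λ (x , x∈C∩C′) → Empty∩⇒∉ C∩I=∅ (C′⊆I (proj₂ (x∈p∩q⁻ C C′ x∈C∩C′))) (proj₁ (x∈p∩q⁻ C C′ x∈C∩C′))) ,
           ∪-⊆ C⊆D (⊆-trans C′⊆I I⊆D))

    no-splitCircuit-below : ∀ {D} → D ⊂ X → ¬ N.Circuit D
    no-splitCircuit-below {D} D⊂X circD with a ∈? D
    ... | no a∉D = Mᴾ.¬¬circuit⊆ (Dependent-split⁻ (proj₁ circD)) λ (Z , Z⊆D , circZ) →
      noC₀C₁ Z (⊆-⊂-trans Z⊆D D⊂X)
        (inj₁ (circZ , inj₂ ((λ a∈Z → a∉D (Z⊆D a∈Z)) ,
                             (λ b∈Z → splitCircuit-∉a⇒∉b circD a∉D (Z⊆D b∈Z)))))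
    ... | yes a∈D = Mᴾ.¬¬circuit⊆ (Dependent-split⁻ (proj₁ circD)) λ (C , C⊆D , circC) →
      noC₀C₁ D D⊂X
        (inj₂ (splitCircuit-∈C₁ D⊂X circD (proj₂ (Nᴾ.circuit⇒CircuitVec circD)) a∈D C⊆D circC))

  InC₂⇒splitCircuit : ∀ {X} → InC₂ X → N.Circuit X
  InC₂⇒splitCircuit ((C₁ , C₂ , circ₁ , circ₂ , a∈C₁ , b∈C₂ , disj , refl , noC₀C₁) , minimal) =
    disjointCircuits⇒splitDependent (proj₂ (Mᴾ.circuit⇒CircuitVec circ₁))
      (proj₂ (Mᴾ.circuit⇒CircuitVec circ₂)) a∈C₁ b∈C₂ disj ,
    λ Y Y⊂X depY → Nᴾ.¬¬circuit⊆ depY λ (D , D⊆Y , circD) →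
      BelowC₂.no-splitCircuit-below noC₀C₁ minimal (⊆-⊂-trans D⊆Y Y⊂X) circD

  splitEulerian-pCircuit : ∀ {k} (Cs : Fin k → Subset n) → M.IsCircuitPartition Cs →
                           ∀ i → PCircuit (Cs i) → N.Eulerian
  splitEulerian-pCircuit {k} Cs (circuits , disj , cover) i pCircuit@(_ , a∈ , b∈ , _) =
    k , Cs , splitCircuits , disj , cover
    where
    splitCircuits : ∀ l → N.Circuit (Cs l)
    splitCircuits l with l ≟ i
    ... | yes refl = InC₀⇒splitCircuit (circuits l , inj₁ pCircuit)
    ... | no  l≢i  = InC₀⇒splitCircuit
      (circuits l , inj₂ (Empty∩⇒∉ (disj l i l≢i) a∈ , Empty∩⇒∉ (disj l i l≢i) b∈))

  splitEulerian-C₂ : ∀ {k} (Cs : Fin (suc k) → Subset n) → M.IsCircuitPartition Cs →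
                     ∀ {i j} → i ≢ j → a ∈ Cs i → b ∈ Cs j → InC₂ (Cs i ∪ Cs j) → N.Eulerian
  splitEulerian-C₂ {k} Cs (circuits , disj , cover) {i} {j} i≢j a∈ b∈ C₂ᵢⱼ =
    k , mergeBlocks Cs j≢i ,
    mergeBlocks-elim Cs j≢i N.Circuit (InC₂⇒splitCircuit C₂ᵢⱼ)
      (λ t t≢i t≢j → InC₀⇒splitCircuit
        (circuits t , inj₂ (Empty∩⇒∉ (disj t i t≢i) a∈ , Empty∩⇒∉ (disj t j t≢j) b∈))) ,
    mergeBlocks-disjoint Cs j≢i disj , mergeBlocks-covers Cs j≢i cover
    where
    j≢i : j ≢ i
    j≢i = i≢j ∘ sym

mainTheorem10 : (p : ℕ) → Prime p → (m n : ℕ) (A : Fin m → Fin n → ℕ) (a b : Fin n) → a ≢ b → (α : ℕ) → ¬ (p ∣ α) → VectorMatroid.Eulerian p A → VectorMatroid.Split.HasPDecomposition p A a b → VectorMatroid.Eulerian p (splitMatrix A α a b)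
mainTheorem10 p p-prime m n A a b a≢b α α≢0 _ (k , Cs , partition , inj₁ (i , _ , _ , pCircuit)) =
  splitEulerian-pCircuit Cs partition i pCircuit
  where open Splitting p p-prime A a b a≢b α α≢0
mainTheorem10 p p-prime m n A a b a≢b α α≢0 _ (zero , _ , _ , inj₂ (() , _))
mainTheorem10 p p-prime m n A a b a≢b α α≢0 _ (suc k , Cs , partition , inj₂ (_ , _ , i≢j , a∈ , b∈ , C₂ᵢⱼ)) =
  splitEulerian-C₂ Cs partition i≢j a∈ b∈ C₂ᵢⱼ
  where open Splitting p p-prime A a b a≢b α α≢0
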